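{- For every positive integer $k$ there is a first-order sentence $\Phi_k$ over the vocabulary $\{E,=\}$ containing $4k$ quantifiers such that for every finite simple graph $G$ with at least $2k$ edges, $G\models\Phi_k$ if and only if $L(G)\ge k$.
   Context: A graph $G$ is viewed as a first-order structure with universe $V(G)$ and a binary relation $E$, where $E(u,v)$ holds iff $u,v$ are adjacent. For a finite simple graph $G$ with $m$ edges, the symmetry breaking-preserving game on $G$ is played by $\mathcal{A}$ and $\mathcal{B}$ who alternately color previously uncolored edges of $G$, $\mathcal{A}$ in red and $\mathcal{B}$ in blue, one edge per move, $\mathcal{A}$ moving first; round $i$ consists of $\mathcal{A}$'s $i$-th move (edge $a_i$) followed by $\mathcal{B}$'s $i$-th move (edge $b_i$). Let $A_i=\{a_1,\dots,a_i\}$, $B_i=\{b_1,\dots,b_i\}$ as subgraphs of $G$. A strategy of $\mathcal{A}$ is a function $S_1$ with $a_i=S_1(b_1,\dots,b_{i-1})$, a strategy of $\mathcal{B}$ is a function $S_2$ with $b_i=S_2(a_1,\dots,a_i)$, both always choosing uncolored edges. $l(S_1,S_2)$ is the maximum $l\le\lfloor m/2\rfloor$ such that $A_i\cong B_i$ for all $i\le l$ in the resulting play, and $L(G)=\max_{S_2}\min_{S_1} l(S_1,S_2)$. -}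

module Defs where

open import Data.Bool using (Bool; true; false; T; _∧_; _∨_; if_then_else_)
open import Data.Nat using (ℕ; zero; suc; _+_; _*_; _≤_; _<_; _<ᵇ_; _/_)
open import Data.Fin using (Fin; toℕ; _≟_)
open import Data.List using (List; []; _∷_; _++_; [_]; length; filterᵇ; cartesianProduct; allFin)
open import Data.Bool.ListAction using (any)
open import Data.List.Membership.Propositional using (_∈_; _∉_)
open import Data.List.Relation.Unary.Unique.Propositional using (Unique)
open import Data.Product using (Σ; _×_; _,_; proj₁; proj₂; ∃)
open import Data.Sum using (_⊎_)
open import Data.Empty using (⊥)
open import Data.Unit using (⊤)
open import Relation.Nullary using (¬_)
open import Relation.Nullary.Decidable using (⌊_⌋)
open import Relation.Binary.PropositionalEquality using (_≡_)
open import Function.Bundles using (_↔_; Inverse)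

record Graph : Set where
  field
    n     : ℕ
    adj   : Fin n → Fin n → Bool
    sym   : ∀ u v → adj u v ≡ adj v u
    irrefl : ∀ v → adj v v ≡ false
open Graph public

-- an edge {u,v} is represented by the ordered pair (u , v) with u < v
isEdge : (G : Graph) → Fin (n G) × Fin (n G) → Bool
isEdge G (u , v) = (toℕ u <ᵇ toℕ v) ∧ adj G u v

Edge : Graph → Set
Edge G = Σ (Fin (n G) × Fin (n G)) (λ p → T (isEdge G p))

edgeCount : Graph → ℕ
edgeCount G = length (filterᵇ (isEdge G) (cartesianProduct (allFin (n G)) (allFin (n G))))

-- First-order logic over the vocabulary {E, =}
-- Formula k : formulas with free variables among Fin k (de Bruijn)

data Formula : ℕ → Set where
  rel   : ∀ {k} → Fin k → Fin k → Formula k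
  eq    : ∀ {k} → Fin k → Fin k → Formula k
  ⊤f ⊥f : ∀ {k} → Formula k
  ¬f_   : ∀ {k} → Formula k → Formula k
  _∧f_ _∨f_ _⇒f_ _⇔f_ : ∀ {k} → Formula k → Formula k → Formula k
  ∀f ∃f : ∀ {k} → Formula (suc k) → Formula k       -- binds variable zero

Sentence : Set
Sentence = Formula 0

quantifiers : ∀ {k} → Formula k → ℕ
quantifiers (rel x y) = 0
quantifiers (eq x y) = 0
quantifiers ⊤f = 0
quantifiers ⊥f = 0
quantifiers (¬f φ) = quantifiers φ
quantifiers (φ ∧f ψ) = quantifiers φ + quantifiers ψ
quantifiers (φ ∨f ψ) = quantifiers φ + quantifiers ψ
quantifiers (φ ⇒f ψ) = quantifiers φ + quantifiers ψ
quantifiers (φ ⇔f ψ) = quantifiers φ + quantifiers ψ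
quantifiers (∀f φ) = suc (quantifiers φ)
quantifiers (∃f φ) = suc (quantifiers φ)

extend : ∀ {k} {A : Set} → A → (Fin k → A) → Fin (suc k) → A
extend a ρ Fin.zero = a
extend a ρ (Fin.suc i) = ρ i

_⊨_⟦_⟧ : ∀ {k} (G : Graph) → Formula k → (Fin k → Fin (n G)) → Set
G ⊨ rel x y ⟦ ρ ⟧ = adj G (ρ x) (ρ y) ≡ true
G ⊨ eq x y ⟦ ρ ⟧ = ρ x ≡ ρ y
G ⊨ ⊤f ⟦ ρ ⟧ = ⊤
G ⊨ ⊥f ⟦ ρ ⟧ = ⊥
G ⊨ ¬f φ ⟦ ρ ⟧ = ¬ (G ⊨ φ ⟦ ρ ⟧)
G ⊨ φ ∧f ψ ⟦ ρ ⟧ = (G ⊨ φ ⟦ ρ ⟧) × (G ⊨ ψ ⟦ ρ ⟧)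
G ⊨ φ ∨f ψ ⟦ ρ ⟧ = (G ⊨ φ ⟦ ρ ⟧) ⊎ (G ⊨ ψ ⟦ ρ ⟧)
G ⊨ φ ⇒f ψ ⟦ ρ ⟧ = (G ⊨ φ ⟦ ρ ⟧) → (G ⊨ ψ ⟦ ρ ⟧)
G ⊨ φ ⇔f ψ ⟦ ρ ⟧ = ((G ⊨ φ ⟦ ρ ⟧) → (G ⊨ ψ ⟦ ρ ⟧)) × ((G ⊨ ψ ⟦ ρ ⟧) → (G ⊨ φ ⟦ ρ ⟧))
G ⊨ ∀f φ ⟦ ρ ⟧ = (v : Fin (n G)) → G ⊨ φ ⟦ extend v ρ ⟧
G ⊨ ∃f φ ⟦ ρ ⟧ = Σ (Fin (n G)) (λ v → G ⊨ φ ⟦ extend v ρ ⟧)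

_⊨_ : Graph → Sentence → Set
G ⊨ φ = G ⊨ φ ⟦ (λ ()) ⟧

module _ (G : Graph) where

  private
    _==_ : Fin (n G) → Fin (n G) → Bool
    u == v = ⌊ u ≟ v ⌋

  touches : List (Edge G) → Fin (n G) → Bool
  touches es v = any (λ e → (proj₁ (proj₁ e) == v) ∨ (proj₂ (proj₁ e) == v)) es

  adjIn : List (Edge G) → Fin (n G) → Fin (n G) → Bool
  adjIn es u v = any (λ e → ((proj₁ (proj₁ e) == u) ∧ (proj₂ (proj₁ e) == v))
                          ∨ ((proj₁ (proj₁ e) == v) ∧ (proj₂ (proj₁ e) == u))) es

  VS : List (Edge G) → Set
  VS es = Σ (Fin (n G)) (λ v → T (touches es v))

  _≅_ : List (Edge G) → List (Edge G) → Set
  es ≅ fs = Σ (VS es ↔ VS fs) (λ f → ∀ x y →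
              adjIn es (proj₁ x) (proj₁ y) ≡ adjIn fs (proj₁ (Inverse.to f x)) (proj₁ (Inverse.to f y)))

  -- a_i = S₁ (b_1 … b_{i-1})
  StrategyA : Set
  StrategyA = List (Edge G) → Edge G

  -- b_i = S₂ (a_1 … a_i)
  StrategyB : Set
  StrategyB = List (Edge G) → Edge G

  histA : StrategyA → List (Edge G) → List (Edge G) → List (Edge G)
  histA S₁ prev [] = []
  histA S₁ prev (b ∷ bs) = S₁ prev ∷ b ∷ histA S₁ (prev ++ [ b ]) bs

  histB : StrategyB → List (Edge G) → List (Edge G) → List (Edge G)
  histB S₂ prev [] = []
  histB S₂ prev (a ∷ as) = a ∷ S₂ (prev ++ [ a ]) ∷ histB S₂ (prev ++ [ a ]) as

  -- S₁ always chooses an uncolored edge (whenever A has to move, i.e.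
  -- fewer than m edges are colored, after any legal history)
  LegalA : StrategyA → Set
  LegalA S₁ = ∀ bs → 2 * length bs < edgeCount G →
              Unique (histA S₁ [] bs) → S₁ bs ∉ histA S₁ [] bs

  LegalB : StrategyB → Set
  LegalB S₂ = ∀ as a → suc (2 * length as) < edgeCount G →
              Unique (histB S₂ [] as ++ [ a ]) → S₂ (as ++ [ a ]) ∉ (histB S₂ [] as ++ [ a ])

  play : StrategyA → StrategyB → ℕ → List (Edge G) × List (Edge G)
  play S₁ S₂ zero = [] , []
  play S₁ S₂ (suc i) =
    let as = proj₁ (play S₁ S₂ i)
        bs = proj₂ (play S₁ S₂ i)
        as' = as ++ [ S₁ bs ]
    in as' , (bs ++ [ S₂ as' ])

  lAtLeast : StrategyA → StrategyB → ℕ → Set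
  lAtLeast S₁ S₂ k = (k ≤ edgeCount G / 2) ×
    (∀ i → i ≤ k → proj₁ (play S₁ S₂ i) ≅ proj₂ (play S₁ S₂ i))

  -- L(G) ≥ k, where L(G) = max_{S₂} min_{S₁} l(S₁,S₂)
  LAtLeast : ℕ → Set
  LAtLeast k = Σ StrategyB (λ S₂ → LegalB S₂ × (∀ S₁ → LegalA S₁ → lAtLeast S₁ S₂ k))

-- Φ_k spells out the first k rounds of the game tree: each round contributes
--   ∀x₁ ∀x₂ (x₁x₂ is an uncoloured edge → ∃y₁ ∃y₂ (y₁y₂ is another uncoloured edge, the red
--   and the blue edges named so far span isomorphic graphs, and the next round holds)),
-- i.e. four quantifiers.  Isomorphism of two graphs spanned by named edges is quantifier-free:
-- it is the finite disjunction, over all maps between the lists of endpoints, of the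
-- conditions making the map an adjacency-preserving bijection.  Hence G ⊨ Φ_k iff B survives
-- the k-round game tree.  A strategy witnessing L(G) ≥ k gives the tree, since A may replay any
-- legal sequence of edges and the answers stay isomorphic; conversely B follows the tree and
-- answers with an arbitrary uncoloured edge once it is exhausted.  As G has at least 2k edges,
-- uncoloured edges exist whenever they are needed.

module Submission where

open import Defs

open import Data.Bool using (Bool; true; false; T; _∧_; _∨_)
open import Data.Bool.ListAction using (any)
open import Data.Bool.Properties using (T?; T-∨; T-∧; T-≡; T-irrelevant; ∨-comm; ∧-comm)
open import Data.Empty using (⊥; ⊥-elim)
open import Data.Fin using (Fin; _≟_; toℕ; _↑ʳ_) renaming (zero to fzero; suc to fsuc)
open import Data.Fin.Properties using (toℕ-injective)
open import Data.List
  using (List; []; _∷_; _++_; _∷ʳ_; [_]; foldl; head; drop; map; length; lookup; allFin; removeAt;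
         cartesianProductWith; cartesianProduct; filterᵇ)
open import Data.List.Membership.Propositional using (_∈_; _∉_; find; lose)
open import Data.List.Membership.Propositional.Properties
  using (∈-++⁻; ∈-++⁺ˡ; ∈-++⁺ʳ; ∈-allFin; ∈-cartesianProductWith⁺; ∈-map⁺; ∈-map⁻; ∈-lookup; ∈-filter⁻)
import Data.List.Membership.DecPropositional as DecMembership
open import Data.List.Properties using (length-removeAt′; length-map; map-++; ++-assoc; ++-identityʳ; foldl-∷ʳ)
open import Data.List.Relation.Binary.Permutation.Propositional
  using (_↭_; ↭-sym; ↭-refl; ↭-prep; ↭-trans; module PermutationReasoning)
open import Data.List.Relation.Binary.Permutation.Propositional.Properties using (∈-resp-↭; ++⁺ʳ; ++⁺ˡ; shift)
open import Data.List.Relation.Binary.Pointwise using (Pointwise; []; _∷_)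
import Data.List.Relation.Binary.Pointwise as Pointwise
open import Data.List.Relation.Unary.All using (all?)
import Data.List.Relation.Unary.All as All
open import Data.List.Relation.Unary.All.Properties using (¬All⇒Any¬)
open import Data.List.Relation.Unary.Any using (Any; here; there)
import Data.List.Relation.Unary.Any as Any
open import Data.List.Relation.Unary.Any.Properties
  using (any⁺; any⁻; lookup-index) renaming (map⁺ to Any-map⁺; map⁻ to Any-map⁻)
open import Data.List.Relation.Unary.Unique.Propositional using (Unique; []; _∷_)
open import Data.List.Relation.Unary.Unique.Propositional.Properties
  using (filter⁺; cartesianProduct⁺; allFin⁺) renaming (++⁺ to Unique-++⁺)
open import Data.List.Reverse using (Reverse; []; _∶_∶ʳ_; reverseView)
open import Data.Maybe using (Maybe; just; nothing; _>>=_)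
import Data.Maybe as Maybe
open import Data.Nat using (ℕ; zero; suc; _+_; _*_; _/_; _≤_; _<_; _<ᵇ_; z≤n; s≤s; _<?_)
open import Data.Nat.DivMod using (m*n/n≡m; /-monoˡ-≤)
open import Data.Nat.Properties
  using (m≤m+n; n≤1+n; 1+n≰n; +-suc; +-identityʳ; *-comm; *-suc; *-monoʳ-≤; <ᵇ⇒<; <⇒<ᵇ; ≮⇒≥; ≤∧≢⇒<;
         <-asym; <⇒≱; ≤-trans; ≤-reflexive)
open import Data.Product using (Σ; _×_; _,_; proj₁; proj₂; ∃)
open import Data.Product.Properties using (≡-dec; ×-≡,≡→≡)
open import Data.Sum using (_⊎_; inj₁; inj₂)
open import Data.Unit using (⊤; tt)
open import Data.Vec using (Vec) renaming ([] to v[]; _∷_ to _v∷_)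
import Data.Vec as Vec
open import Data.Vec.Properties using (lookup∘tabulate)
open import Function using (_∘_)
open import Function.Bundles using (_⇔_; mk⇔; _↔_; Inverse; mk↔ₛ′; Equivalence)
open import Function.Properties.Inverse using (↔-trans; ↔-refl)
open import Relation.Binary.Definitions using (DecidableEquality)
open import Relation.Binary.PropositionalEquality using (_≡_; _≢_; refl; trans; cong; cong₂; subst; subst₂)
import Relation.Binary.PropositionalEquality as ≡
open import Relation.Nullary.Decidable using (⌊_⌋; toWitness; fromWitness; map′; yes; no)

T-injective : ∀ {a b} → (T a → T b) → (T b → T a) → a ≡ b
T-injective {false} {false} _ _ = refl
T-injective {false} {true} _ g = ⊥-elim (g tt)
T-injective {true} {false} f _ = ⊥-elim (f tt)
T-injective {true} {true} _ _ = refl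

2*k≤m⇒k≤m/2 : ∀ {k m} → 2 * k ≤ m → k ≤ m / 2
2*k≤m⇒k≤m/2 {k} {m} 2k≤m =
  subst (_≤ m / 2) (m*n/n≡m k 2) (subst (λ j → j / 2 ≤ m / 2) (*-comm 2 k) (/-monoˡ-≤ 2 2k≤m))

2+2*i≤m : ∀ {i k m} → suc i ≤ k → 2 * k ≤ m → suc (suc (2 * i)) ≤ m
2+2*i≤m {i} {k} i<k 2k≤m = ≤-trans (subst (_≤ 2 * k) (*-suc 2 i) (*-monoʳ-≤ 2 i<k)) 2k≤m

module _ {A : Set} where

  length-∷ʳ : ∀ (xs : List A) x → length (xs ∷ʳ x) ≡ suc (length xs)
  length-∷ʳ [] x = refl
  length-∷ʳ (_ ∷ xs) x = cong suc (length-∷ʳ xs x)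

  Unique-∷ʳ : ∀ {xs : List A} {x} → Unique xs → x ∉ xs → Unique (xs ∷ʳ x)
  Unique-∷ʳ u x∉ = Unique-++⁺ u (All.[] ∷ []) λ { (x∈ , here refl) → x∉ x∈ }

  Unique-round : ∀ {h : List A} {a b} → Unique h → a ∉ h → b ∉ h ∷ʳ a → Unique (h ++ a ∷ b ∷ [])
  Unique-round {h} {a} {b} u a∉ b∉ = subst Unique (++-assoc h [ a ] [ b ]) (Unique-∷ʳ (Unique-∷ʳ u a∉) b∉)

  Unique-++⁻ˡ : ∀ (xs : List A) {ys} → Unique (xs ++ ys) → Unique xs
  Unique-++⁻ˡ [] _ = []
  Unique-++⁻ˡ (x ∷ xs) (x∉ ∷ u) = All.tabulate (λ y∈ → All.lookup x∉ (∈-++⁺ˡ y∈)) ∷ Unique-++⁻ˡ xs u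

  Unique-++-∷⇒∉ : ∀ (xs : List A) {x ys} → Unique (xs ++ x ∷ ys) → x ∉ xs
  Unique-++-∷⇒∉ (y ∷ xs) (y∉ ∷ _) (here refl) = All.lookup y∉ (∈-++⁺ʳ xs (here refl)) refl
  Unique-++-∷⇒∉ (y ∷ xs) (_ ∷ u) (there x∈) = Unique-++-∷⇒∉ xs u x∈

  ∉∷⇒∉∷ʳ : ∀ {h xs : List A} {a b} → h ↭ xs → b ∉ a ∷ xs → b ∉ h ∷ʳ a
  ∉∷⇒∉∷ʳ {h} h↭ b∉ b∈ with ∈-++⁻ h b∈
  ... | inj₁ b∈h = b∉ (there (∈-resp-↭ h↭ b∈h))
  ... | inj₂ (here b≡a) = b∉ (here b≡a)

  ∉∷ʳ⇒∉∷ : ∀ {h xs : List A} {a b} → h ↭ xs → b ∉ h ∷ʳ a → b ∉ a ∷ xs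
  ∉∷ʳ⇒∉∷ {h} h↭ b∉ (here b≡a) = b∉ (∈-++⁺ʳ h (here b≡a))
  ∉∷ʳ⇒∉∷ h↭ b∉ (there b∈) = b∉ (∈-++⁺ˡ (∈-resp-↭ (↭-sym h↭) b∈))

  ↭-round : ∀ {h : List A} as bs {a b} → h ↭ as ++ bs → h ++ a ∷ b ∷ [] ↭ (as ∷ʳ a) ++ (bs ∷ʳ b)
  ↭-round {h} as bs {a} {b} h↭ = begin
    h ++ a ∷ b ∷ [] ↭⟨ ++⁺ʳ _ h↭ ⟩
    (as ++ bs) ++ a ∷ b ∷ [] ≡⟨ ++-assoc as bs _ ⟩
    as ++ (bs ++ [ a ] ++ [ b ]) ↭⟨ ++⁺ˡ as (shift a bs [ b ]) ⟩
    as ++ (a ∷ bs ∷ʳ b) ≡⟨ ≡.sym (++-assoc as [ a ] (bs ∷ʳ b)) ⟩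
    (as ∷ʳ a) ++ (bs ∷ʳ b) ∎
    where open PermutationReasoning


  ∈-removeAt : ∀ {x y : A} {ys} (x∈ : x ∈ ys) → y ∈ ys → x ≢ y → y ∈ removeAt ys (Any.index x∈)
  ∈-removeAt (here refl) (here refl) x≢y = ⊥-elim (x≢y refl)
  ∈-removeAt (here refl) (there y∈) _ = y∈
  ∈-removeAt (there x∈) (here refl) _ = here refl
  ∈-removeAt (there x∈) (there y∈) x≢y = there (∈-removeAt x∈ y∈ x≢y)

  Unique-⊆⇒length≤ : ∀ {xs ys : List A} → Unique xs → (∀ {x} → x ∈ xs → x ∈ ys) → length xs ≤ length ys
  Unique-⊆⇒length≤ {[]} _ _ = z≤n
  Unique-⊆⇒length≤ {x ∷ xs} {ys} (x∉ ∷ u) xs⊆ys =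
    subst (_ ≤_) (≡.sym (length-removeAt′ ys (Any.index x∈)))
      (s≤s (Unique-⊆⇒length≤ u (λ y∈ → ∈-removeAt x∈ (xs⊆ys (there y∈)) (All.lookup x∉ y∈))))
    where
    x∈ : x ∈ ys
    x∈ = xs⊆ys (here refl)

allVecs : (n m : ℕ) → List (Vec (Fin m) n)
allVecs zero m = [ v[] ]
allVecs (suc n) m = cartesianProductWith _v∷_ (allFin m) (allVecs n m)

∈-allVecs : ∀ {n m} (v : Vec (Fin m) n) → v ∈ allVecs n m
∈-allVecs v[] = here refl
∈-allVecs (i v∷ v) = ∈-cartesianProductWith⁺ _v∷_ (∈-allFin i) (∈-allVecs v)

-- Isomorphisms of marked subgraphs

module _ {V : Set} where

  Marked : (V → Bool) → Set
  Marked t = Σ V (λ v → T (t v))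

  SubgraphIso : (V → Bool) → (V → V → Bool) → (V → Bool) → (V → V → Bool) → Set
  SubgraphIso t a t′ a′ = Σ (Marked t ↔ Marked t′) (λ f → ∀ x y →
    a (proj₁ x) (proj₁ y) ≡ a′ (proj₁ (Inverse.to f x)) (proj₁ (Inverse.to f y)))

  marked-≡ : {t : V → Bool} {x y : Marked t} → proj₁ x ≡ proj₁ y → x ≡ y
  marked-≡ {x = v , p} {.v , q} refl = cong (v ,_) (T-irrelevant p q)

  marked-↔ : {t t′ : V → Bool} → (∀ v → t v ≡ t′ v) → Marked t ↔ Marked t′
  marked-↔ e = mk↔ₛ′ (λ (v , p) → v , subst T (e v) p) (λ (v , p) → v , subst T (≡.sym (e v)) p)
    (λ _ → marked-≡ refl) (λ _ → marked-≡ refl)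

  SubgraphIso-resp : {t s t′ s′ : V → Bool} {a b a′ b′ : V → V → Bool} →
    (∀ v → t v ≡ s v) → (∀ u v → a u v ≡ b u v) →
    (∀ v → t′ v ≡ s′ v) → (∀ u v → a′ u v ≡ b′ u v) →
    SubgraphIso t a t′ a′ → SubgraphIso s b s′ b′
  SubgraphIso-resp et ea et′ ea′ (f , adj-pres) =
    ↔-trans (marked-↔ (≡.sym ∘ et)) (↔-trans f (marked-↔ et′)) ,
    λ (u , _) (v , _) → trans (≡.sym (ea u v)) (trans (adj-pres _ _) (ea′ _ _))

  module Enumerated {n m : ℕ} {t t′ : V → Bool} {a a′ : V → V → Bool}
    (x : Fin n → V) (x-marked : ∀ p → T (t (x p))) (x-onto : ∀ v → T (t v) → Σ (Fin n) (λ p → x p ≡ v))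
    (y : Fin m → V) (y-marked : ∀ q → T (t′ (y q))) (y-onto : ∀ v → T (t′ v) → Σ (Fin m) (λ q → y q ≡ v))
    where

    record IsoMap (σ : Fin n → Fin m) : Set where
      field
        image-≡ : ∀ p q → (x p ≡ x q → y (σ p) ≡ y (σ q)) × (y (σ p) ≡ y (σ q) → x p ≡ x q)
        image-onto : ∀ q → Σ (Fin n) (λ p → y q ≡ y (σ p))
        image-adj : ∀ p q → a (x p) (x q) ≡ a′ (y (σ p)) (y (σ q))

    IsoMap-cong : ∀ {σ τ} → (∀ p → σ p ≡ τ p) → IsoMap σ → IsoMap τ
    IsoMap-cong {σ} {τ} σ≗τ iσ = record
      { image-≡ = λ p q → (λ e → trans (≡.sym (y≗ p)) (trans (proj₁ (image-≡ p q) e) (y≗ q)))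
                        , (λ e → proj₂ (image-≡ p q) (trans (y≗ p) (trans e (≡.sym (y≗ q)))))
      ; image-onto = λ q → proj₁ (image-onto q) , trans (proj₂ (image-onto q)) (y≗ _)
      ; image-adj = λ p q → trans (image-adj p q) (cong₂ a′ (y≗ p) (y≗ q))
      }
      where
      open IsoMap iσ
      y≗ : ∀ p → y (σ p) ≡ y (τ p)
      y≗ p = cong y (σ≗τ p)

    SubgraphIso⇒IsoMap : SubgraphIso t a t′ a′ → Σ (Fin n → Fin m) IsoMap
    SubgraphIso⇒IsoMap (f , adj-pres) = σ , record
      { image-≡ = λ p q →
          (λ e → trans (yσ p) (trans (cong (proj₁ ∘ to) (marked-≡ {x = X p} {X q} e)) (≡.sym (yσ q))))
        , (λ e → cong proj₁ (trans (≡.sym (strictlyInverseʳ (X p)))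
            (trans (cong from (marked-≡ {x = to (X p)} {to (X q)} (trans (≡.sym (yσ p)) (trans e (yσ q)))))
              (strictlyInverseʳ (X q)))))
      ; image-onto = image-onto
      ; image-adj = λ p q → trans (adj-pres (X p) (X q)) (≡.sym (cong₂ a′ (yσ p) (yσ q)))
      }
      where
      open Inverse f
      X : Fin n → Marked t
      X p = x p , x-marked p
      σ : Fin n → Fin m
      σ p = proj₁ (y-onto _ (proj₂ (to (X p))))
      yσ : ∀ p → y (σ p) ≡ proj₁ (to (X p))
      yσ p = proj₂ (y-onto _ (proj₂ (to (X p))))
      image-onto : ∀ q → Σ (Fin n) (λ p → y q ≡ y (σ p))
      image-onto q = p , trans (≡.sym (cong proj₁ (strictlyInverseˡ Y)))
                           (trans (cong (proj₁ ∘ to) (marked-≡ {x = from Y} {X p} (≡.sym xp≡))) (≡.sym (yσ p)))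
        where
        Y : Marked t′
        Y = y q , y-marked q
        p : Fin n
        p = proj₁ (x-onto _ (proj₂ (from Y)))
        xp≡ : x p ≡ proj₁ (from Y)
        xp≡ = proj₂ (x-onto _ (proj₂ (from Y)))

    IsoMap⇒SubgraphIso : (σ : Fin n → Fin m) → IsoMap σ → SubgraphIso t a t′ a′
    IsoMap⇒SubgraphIso σ iσ = mk↔ₛ′ to from to∘from from∘to , adj-pres
      where
      open IsoMap iσ
      index : (v : Marked t) → Fin n
      index (v , tv) = proj₁ (x-onto v tv)
      to : Marked t → Marked t′
      to v = y (σ (index v)) , y-marked _
      from : Marked t′ → Marked t
      from (w , tw) = x (proj₁ (image-onto (proj₁ (y-onto w tw)))) , x-marked _
      to∘from : ∀ w → to (from w) ≡ w
      to∘from (w , tw) = marked-≡ (trans (proj₁ (image-≡ _ p) (proj₂ (x-onto (x p) (x-marked p))))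
                                    (trans (≡.sym (proj₂ (image-onto q))) (proj₂ (y-onto w tw))))
        where
        q : Fin m
        q = proj₁ (y-onto w tw)
        p : Fin n
        p = proj₁ (image-onto q)
      from∘to : ∀ v → from (to v) ≡ v
      from∘to (v , tv) = marked-≡ (trans (proj₂ (image-≡ _ p)
                                      (trans (≡.sym (proj₂ (image-onto q))) (proj₂ (y-onto _ (y-marked (σ p))))))
                                    (proj₂ (x-onto v tv)))
        where
        p : Fin n
        p = proj₁ (x-onto v tv)
        q : Fin m
        q = proj₁ (y-onto _ (y-marked (σ p)))
      adj-pres : ∀ u v → a (proj₁ u) (proj₁ v) ≡ a′ (proj₁ (to u)) (proj₁ (to v))
      adj-pres (u , tu) (v , tv) = trans (≡.sym (cong₂ a (proj₂ (x-onto u tu)) (proj₂ (x-onto v tv)))) (image-adj _ _)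

-- Unordered pairs and the subgraphs they span

_≐_ : {V : Set} → V × V → V × V → Set
p ≐ q = (proj₁ p ≡ proj₁ q × proj₂ p ≡ proj₂ q) ⊎ (proj₁ p ≡ proj₂ q × proj₂ p ≡ proj₁ q)

≐-sym : {V : Set} {p q : V × V} → p ≐ q → q ≐ p
≐-sym (inj₁ (e₁ , e₂)) = inj₁ (≡.sym e₁ , ≡.sym e₂)
≐-sym (inj₂ (e₁ , e₂)) = inj₂ (≡.sym e₂ , ≡.sym e₁)

≐-trans : {V : Set} {p q r : V × V} → p ≐ q → q ≐ r → p ≐ r
≐-trans (inj₁ (e₁ , e₂)) (inj₁ (f₁ , f₂)) = inj₁ (trans e₁ f₁ , trans e₂ f₂)
≐-trans (inj₁ (e₁ , e₂)) (inj₂ (f₁ , f₂)) = inj₂ (trans e₁ f₁ , trans e₂ f₂)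
≐-trans (inj₂ (e₁ , e₂)) (inj₁ (f₁ , f₂)) = inj₂ (trans e₁ f₂ , trans e₂ f₁)
≐-trans (inj₂ (e₁ , e₂)) (inj₂ (f₁ , f₂)) = inj₁ (trans e₁ f₂ , trans e₂ f₁)

endpoints : {V : Set} → List (V × V) → List V
endpoints [] = []
endpoints (p ∷ ps) = proj₁ p ∷ proj₂ p ∷ endpoints ps

mapPair : {V W : Set} → (V → W) → V × V → W × W
mapPair f p = f (proj₁ p) , f (proj₂ p)

mapPairs : {V W : Set} → (V → W) → List (V × V) → List (W × W)
mapPairs f = map (mapPair f)

endpoints-mapPairs : {V W : Set} (f : V → W) (ps : List (V × V)) →
  endpoints (mapPairs f ps) ≡ map f (endpoints ps)
endpoints-mapPairs f [] = refl
endpoints-mapPairs f (p ∷ ps) = cong (λ es → f (proj₁ p) ∷ f (proj₂ p) ∷ es) (endpoints-mapPairs f ps)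

module _ {N : ℕ} where

  private
    _==_ : Fin N → Fin N → Bool
    u == v = ⌊ u ≟ v ⌋

  _≐ᵇ_ : Fin N × Fin N → Fin N × Fin N → Bool
  p ≐ᵇ q = ((proj₁ p == proj₁ q) ∧ (proj₂ p == proj₂ q)) ∨ ((proj₁ p == proj₂ q) ∧ (proj₂ p == proj₁ q))

  touchesᵖ : List (Fin N × Fin N) → Fin N → Bool
  touchesᵖ ps v = any (λ p → (proj₁ p == v) ∨ (proj₂ p == v)) ps

  adjInᵖ : List (Fin N × Fin N) → Fin N → Fin N → Bool
  adjInᵖ ps u v = any (_≐ᵇ (u , v)) ps

  private
    ∨⁻ : ∀ x {y} → T (x ∨ y) → T x ⊎ T y
    ∨⁻ x = Equivalence.to (T-∨ {x})
    ∨⁺ : ∀ x {y} → T x ⊎ T y → T (x ∨ y)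
    ∨⁺ x = Equivalence.from (T-∨ {x})
    ∧⁻ : ∀ x {y} → T (x ∧ y) → T x × T y
    ∧⁻ x = Equivalence.to (T-∧ {x})
    ∧⁺ : ∀ x {y} → T x × T y → T (x ∧ y)
    ∧⁺ x = Equivalence.from (T-∧ {x})
    ==⇒≡ : ∀ {u v} → T (u == v) → u ≡ v
    ==⇒≡ = toWitness
    ≡⇒== : ∀ {u v} → u ≡ v → T (u == v)
    ≡⇒== = fromWitness

  T-≐ᵇ : ∀ {p q} → T (p ≐ᵇ q) ⇔ p ≐ q
  T-≐ᵇ {a , b} {c , d} = mk⇔ to from
    where
    to : T ((a , b) ≐ᵇ (c , d)) → (a , b) ≐ (c , d)
    to t with ∨⁻ ((a == c) ∧ (b == d)) t
    ... | inj₁ t′ = let (e₁ , e₂) = ∧⁻ (a == c) t′ in inj₁ (==⇒≡ e₁ , ==⇒≡ e₂)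
    ... | inj₂ t′ = let (e₁ , e₂) = ∧⁻ (a == d) t′ in inj₂ (==⇒≡ e₁ , ==⇒≡ e₂)
    from : (a , b) ≐ (c , d) → T ((a , b) ≐ᵇ (c , d))
    from (inj₁ (e₁ , e₂)) = ∨⁺ ((a == c) ∧ (b == d)) (inj₁ (∧⁺ (a == c) (≡⇒== e₁ , ≡⇒== e₂)))
    from (inj₂ (e₁ , e₂)) = ∨⁺ ((a == c) ∧ (b == d)) (inj₂ (∧⁺ (a == d) (≡⇒== e₁ , ≡⇒== e₂)))

  touchesᵖ⇔∈endpoints : ∀ ps v → T (touchesᵖ ps v) ⇔ v ∈ endpoints ps
  touchesᵖ⇔∈endpoints ps v = mk⇔ (to ps) (from ps)
    where
    to : ∀ ps → T (touchesᵖ ps v) → v ∈ endpoints ps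
    to ((a , b) ∷ ps) t with ∨⁻ ((a == v) ∨ (b == v)) t
    ... | inj₂ t′ = there (there (to ps t′))
    ... | inj₁ t′ with ∨⁻ (a == v) t′
    ...   | inj₁ e = here (≡.sym (==⇒≡ e))
    ...   | inj₂ e = there (here (≡.sym (==⇒≡ e)))
    from : ∀ ps → v ∈ endpoints ps → T (touchesᵖ ps v)
    from ((a , b) ∷ ps) (here e) = ∨⁺ ((a == v) ∨ (b == v)) (inj₁ (∨⁺ (a == v) (inj₁ (≡⇒== (≡.sym e)))))
    from ((a , b) ∷ ps) (there (here e)) = ∨⁺ ((a == v) ∨ (b == v)) (inj₁ (∨⁺ (a == v) (inj₂ (≡⇒== (≡.sym e)))))
    from ((a , b) ∷ ps) (there (there v∈)) = ∨⁺ ((a == v) ∨ (b == v)) (inj₂ (from ps v∈))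

  adjInᵖ⇔Any : ∀ ps u v → T (adjInᵖ ps u v) ⇔ Any (_≐ (u , v)) ps
  adjInᵖ⇔Any ps u v = mk⇔ (Any.map (Equivalence.to T-≐ᵇ) ∘ any⁻ _ ps) (any⁺ _ ∘ Any.map (Equivalence.from T-≐ᵇ))

  touchesᵖ-resp : ∀ {ps qs} → Pointwise _≐_ ps qs → ∀ v → touchesᵖ ps v ≡ touchesᵖ qs v
  touchesᵖ-resp [] v = refl
  touchesᵖ-resp {_ ∷ _} {_ ∷ _} (inj₁ (refl , refl) ∷ rs) v = cong (_ ∨_) (touchesᵖ-resp rs v)
  touchesᵖ-resp {(a , b) ∷ _} {_ ∷ _} (inj₂ (refl , refl) ∷ rs) v =
    cong₂ _∨_ (∨-comm (a == v) (b == v)) (touchesᵖ-resp rs v)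

  adjInᵖ-resp : ∀ {ps qs} → Pointwise _≐_ ps qs → ∀ u v → adjInᵖ ps u v ≡ adjInᵖ qs u v
  adjInᵖ-resp [] u v = refl
  adjInᵖ-resp {_ ∷ _} {_ ∷ _} (inj₁ (refl , refl) ∷ rs) u v = cong (_ ∨_) (adjInᵖ-resp rs u v)
  adjInᵖ-resp {(a , b) ∷ _} {_ ∷ _} (inj₂ (refl , refl) ∷ rs) u v =
    cong₂ _∨_ (trans (∨-comm ((a == u) ∧ (b == v)) ((a == v) ∧ (b == u)))
                     (cong₂ _∨_ (∧-comm (a == v) (b == u)) (∧-comm (a == u) (b == v))))
              (adjInᵖ-resp rs u v)

module _ (G : Graph) where

  touches-edges : ∀ es v → touches G es v ≡ touchesᵖ (map proj₁ es) v
  touches-edges [] v = refl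
  touches-edges (e ∷ es) v = cong (_ ∨_) (touches-edges es v)

  adjIn-edges : ∀ es u v → adjIn G es u v ≡ adjInᵖ (map proj₁ es) u v
  adjIn-edges [] u v = refl
  adjIn-edges (e ∷ es) u v = cong (_ ∨_) (adjIn-edges es u v)

  ≅⇔SubgraphIso : ∀ {ps qs} (es fs : List (Edge G)) →
    Pointwise _≐_ ps (map proj₁ es) → Pointwise _≐_ qs (map proj₁ fs) →
    _≅_ G es fs ⇔ SubgraphIso (touchesᵖ ps) (adjInᵖ ps) (touchesᵖ qs) (adjInᵖ qs)
  ≅⇔SubgraphIso es fs rs ss = mk⇔
    (SubgraphIso-resp (λ v → trans (touches-edges es v) (≡.sym (touchesᵖ-resp rs v)))
                      (λ u v → trans (adjIn-edges es u v) (≡.sym (adjInᵖ-resp rs u v)))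
                      (λ v → trans (touches-edges fs v) (≡.sym (touchesᵖ-resp ss v)))
                      (λ u v → trans (adjIn-edges fs u v) (≡.sym (adjInᵖ-resp ss u v))))
    (SubgraphIso-resp (λ v → trans (touchesᵖ-resp rs v) (≡.sym (touches-edges es v)))
                      (λ u v → trans (adjInᵖ-resp rs u v) (≡.sym (adjIn-edges es u v)))
                      (λ v → trans (touchesᵖ-resp ss v) (≡.sym (touches-edges fs v)))
                      (λ u v → trans (adjInᵖ-resp ss u v) (≡.sym (adjIn-edges fs u v))))

module Edges (G : Graph) where

  edge-ordered : (e : Edge G) → toℕ (proj₁ (proj₁ e)) < toℕ (proj₂ (proj₁ e))
  edge-ordered ((u , v) , t) = <ᵇ⇒< (toℕ u) (toℕ v) (proj₁ (Equivalence.to T-∧ t))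

  edge-adj : (e : Edge G) → adj G (proj₁ (proj₁ e)) (proj₂ (proj₁ e)) ≡ true
  edge-adj ((u , v) , t) = Equivalence.to T-≡ (proj₂ (Equivalence.to (T-∧ {toℕ u <ᵇ toℕ v}) t))

  adj⇒edge : ∀ u v → adj G u v ≡ true → Σ (Edge G) (λ e → (u , v) ≐ proj₁ e)
  adj⇒edge u v uv with toℕ u <ᵇ toℕ v in u<ᵇv
  ... | true = ((u , v) , subst (λ b → T (b ∧ adj G u v)) (≡.sym u<ᵇv) (Equivalence.from T-≡ uv)) , inj₁ (refl , refl)
  ... | false =
    ((v , u) , Equivalence.from T-∧ (<⇒<ᵇ v<u , Equivalence.from T-≡ (trans (sym G v u) uv))) , inj₂ (refl , refl)
    where
    u≢v : toℕ u ≢ toℕ v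
    u≢v e with refl ← toℕ-injective e = case (trans (≡.sym (irrefl G u)) uv)
      where case : false ≡ true → ⊥
            case ()
    v<u : toℕ v < toℕ u
    v<u = ≤∧≢⇒< (≮⇒≥ (λ u<v → subst T u<ᵇv (<⇒<ᵇ u<v))) (u≢v ∘ ≡.sym)

  ≐-edge-injective : ∀ {p} (e f : Edge G) → p ≐ proj₁ e → p ≐ proj₁ f → e ≡ f
  ≐-edge-injective e f pe pf with ≐-trans (≐-sym pe) pf
  ... | inj₁ (e₁ , e₂) = marked-≡ (×-≡,≡→≡ (e₁ , e₂))
  ... | inj₂ (e₁ , e₂) =
    ⊥-elim (<-asym (edge-ordered e) (subst₂ (λ a b → toℕ a < toℕ b) (≡.sym e₂) (≡.sym e₁) (edge-ordered f)))

  _≟ᵖ_ : DecidableEquality (Fin (n G) × Fin (n G))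
  _≟ᵖ_ = ≡-dec _≟_ _≟_

  _≟ₑ_ : DecidableEquality (Edge G)
  e ≟ₑ f = map′ marked-≡ (cong proj₁) (proj₁ e ≟ᵖ proj₁ f)

  edgePairs : List (Fin (n G) × Fin (n G))
  edgePairs = filterᵇ (isEdge G) (cartesianProduct (allFin (n G)) (allFin (n G)))

  open DecMembership _≟ᵖ_ using (_∈?_)

  edgePairs-unique : Unique edgePairs
  edgePairs-unique = filter⁺ (T? ∘ isEdge G) (cartesianProduct⁺ (allFin⁺ _) (allFin⁺ _))

  freshEdge : (h : List (Edge G)) → length h < edgeCount G → Σ (Edge G) (_∉ h)
  freshEdge h h<m with all? (_∈? map proj₁ h) edgePairs
  ... | yes all∈ = ⊥-elim (<⇒≱ h<m (≤-trans (Unique-⊆⇒length≤ edgePairs-unique (All.lookup all∈))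
                                              (≤-reflexive (length-map proj₁ h))))
  ... | no ¬all with (p , p∈ , p∉) ← find (¬All⇒Any¬ (_∈? map proj₁ h) edgePairs ¬all) =
    (p , proj₂ (∈-filter⁻ (T? ∘ isEdge G) {xs = cartesianProduct (allFin (n G)) (allFin (n G))} p∈)) ,
    p∉ ∘ ∈-map⁺ proj₁

-- Quantifier-free formulas and isomorphism

data QF (k : ℕ) : Set where
  eq′ rel′ : Fin k → Fin k → QF k
  ⊤′ ⊥′ : QF k
  ¬′_ : QF k → QF k
  _∧′_ _∨′_ _⇔′_ : QF k → QF k → QF k

⌜_⌝ : ∀ {k} → QF k → Formula k
⌜ eq′ x y ⌝ = eq x y
⌜ rel′ x y ⌝ = rel x y
⌜ ⊤′ ⌝ = ⊤f
⌜ ⊥′ ⌝ = ⊥f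
⌜ ¬′ φ ⌝ = ¬f ⌜ φ ⌝
⌜ φ ∧′ ψ ⌝ = ⌜ φ ⌝ ∧f ⌜ ψ ⌝
⌜ φ ∨′ ψ ⌝ = ⌜ φ ⌝ ∨f ⌜ ψ ⌝
⌜ φ ⇔′ ψ ⌝ = ⌜ φ ⌝ ⇔f ⌜ ψ ⌝

quantifiers-⌜⌝ : ∀ {k} (φ : QF k) → quantifiers ⌜ φ ⌝ ≡ 0
quantifiers-⌜⌝ (eq′ x y) = refl
quantifiers-⌜⌝ (rel′ x y) = refl
quantifiers-⌜⌝ ⊤′ = refl
quantifiers-⌜⌝ ⊥′ = refl
quantifiers-⌜⌝ (¬′ φ) = quantifiers-⌜⌝ φ
quantifiers-⌜⌝ (φ ∧′ ψ) = cong₂ _+_ (quantifiers-⌜⌝ φ) (quantifiers-⌜⌝ ψ)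
quantifiers-⌜⌝ (φ ∨′ ψ) = cong₂ _+_ (quantifiers-⌜⌝ φ) (quantifiers-⌜⌝ ψ)
quantifiers-⌜⌝ (φ ⇔′ ψ) = cong₂ _+_ (quantifiers-⌜⌝ φ) (quantifiers-⌜⌝ ψ)

⋀ ⋁ : ∀ {k} {A : Set} → List A → (A → QF k) → QF k
⋀ [] φ = ⊤′
⋀ (x ∷ xs) φ = φ x ∧′ ⋀ xs φ
⋁ [] φ = ⊥′
⋁ (x ∷ xs) φ = φ x ∨′ ⋁ xs φ

module Semantics (G : Graph) {k : ℕ} (ρ : Fin k → Fin (n G)) where

  Holds : QF k → Set
  Holds φ = G ⊨ ⌜ φ ⌝ ⟦ ρ ⟧

  module _ {A : Set} (φ : A → QF k) where

    ⋀⁺ : ∀ xs → (∀ {x} → x ∈ xs → Holds (φ x)) → Holds (⋀ xs φ)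
    ⋀⁺ [] _ = tt
    ⋀⁺ (x ∷ xs) h = h (here refl) , ⋀⁺ xs (h ∘ there)

    ⋀⁻ : ∀ xs → Holds (⋀ xs φ) → ∀ {x} → x ∈ xs → Holds (φ x)
    ⋀⁻ (x ∷ xs) (s , _) (here refl) = s
    ⋀⁻ (x ∷ xs) (_ , s) (there x∈) = ⋀⁻ xs s x∈

    ⋁⁺ : ∀ xs {x} → x ∈ xs → Holds (φ x) → Holds (⋁ xs φ)
    ⋁⁺ (x ∷ xs) (here refl) s = inj₁ s
    ⋁⁺ (x ∷ xs) (there x∈) s = inj₂ (⋁⁺ xs x∈ s)

    ⋁⁻ : ∀ xs → Holds (⋁ xs φ) → ∃ λ x → x ∈ xs × Holds (φ x)
    ⋁⁻ (x ∷ xs) (inj₁ s) = x , here refl , s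
    ⋁⁻ (x ∷ xs) (inj₂ s) = let (y , y∈ , s′) = ⋁⁻ xs s in y , there y∈ , s′

module _ {k : ℕ} where

  samePairQF : Fin k × Fin k → Fin k × Fin k → QF k
  samePairQF p q = (eq′ (proj₁ p) (proj₁ q) ∧′ eq′ (proj₂ p) (proj₂ q))
                ∨′ (eq′ (proj₁ p) (proj₂ q) ∧′ eq′ (proj₂ p) (proj₁ q))

  adjacentQF : List (Fin k × Fin k) → Fin k → Fin k → QF k
  adjacentQF ps u v = ⋁ ps (λ p → samePairQF p (u , v))

  isoMapQF : (ps qs : List (Fin k × Fin k)) →
    (Fin (length (endpoints ps)) → Fin (length (endpoints qs))) → QF k
  isoMapQF ps qs σ =
       ⋀ (allFin _) (λ i → ⋀ (allFin _) (λ j → eq′ (x i) (x j) ⇔′ eq′ (y (σ i)) (y (σ j))))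
    ∧′ (⋀ (allFin _) (λ j → ⋁ (allFin _) (λ i → eq′ (y j) (y (σ i))))
    ∧′ ⋀ (allFin _) (λ i → ⋀ (allFin _) (λ j →
          adjacentQF ps (x i) (x j) ⇔′ adjacentQF qs (y (σ i)) (y (σ j)))))
    where
    x : Fin (length (endpoints ps)) → Fin k
    x = lookup (endpoints ps)
    y : Fin (length (endpoints qs)) → Fin k
    y = lookup (endpoints qs)

  isoQF : List (Fin k × Fin k) → List (Fin k × Fin k) → QF k
  isoQF ps qs = ⋁ (allVecs _ _) (λ w → isoMapQF ps qs (Vec.lookup w))

module IsoFormula (G : Graph) {k : ℕ} (ρ : Fin k → Fin (n G)) where

  open Semantics G ρ

  adjacentQF⇔adjInᵖ : ∀ ps u v → Holds (adjacentQF ps u v) ⇔ T (adjInᵖ (mapPairs ρ ps) (ρ u) (ρ v))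
  adjacentQF⇔adjInᵖ ps u v = mk⇔
    (λ s → let (p , p∈ , h) = ⋁⁻ _ ps s in Equivalence.from (adjInᵖ⇔Any _ _ _) (Any-map⁺ (lose p∈ h)))
    (λ t → let (p , p∈ , h) = find (Any-map⁻ (Equivalence.to (adjInᵖ⇔Any _ _ _) t)) in ⋁⁺ _ ps p∈ h)

  vertexAt : (ps : List (Fin k × Fin k)) → Fin (length (endpoints ps)) → Fin (n G)
  vertexAt ps = ρ ∘ lookup (endpoints ps)

  vertexAt-marked : ∀ ps i → T (touchesᵖ (mapPairs ρ ps) (vertexAt ps i))
  vertexAt-marked ps i = Equivalence.from (touchesᵖ⇔∈endpoints _ _)
    (subst (vertexAt ps i ∈_) (≡.sym (endpoints-mapPairs ρ ps)) (∈-map⁺ ρ (∈-lookup i)))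

  vertexAt-onto : ∀ ps v → T (touchesᵖ (mapPairs ρ ps) v) → Σ (Fin (length (endpoints ps))) (λ i → vertexAt ps i ≡ v)
  vertexAt-onto ps v t
    with ∈-map⁻ ρ (subst (v ∈_) (endpoints-mapPairs ρ ps) (Equivalence.to (touchesᵖ⇔∈endpoints _ _) t))
  ... | j , j∈ , v≡ρj = Any.index j∈ , trans (cong ρ (≡.sym (lookup-index j∈))) (≡.sym v≡ρj)

  module _ (ps qs : List (Fin k × Fin k)) where

    open Enumerated {t = touchesᵖ (mapPairs ρ ps)} {touchesᵖ (mapPairs ρ qs)}
                    {adjInᵖ (mapPairs ρ ps)} {adjInᵖ (mapPairs ρ qs)}
                    (vertexAt ps) (vertexAt-marked ps) (vertexAt-onto ps)
                    (vertexAt qs) (vertexAt-marked qs) (vertexAt-onto qs)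

    isoMapQF⇔IsoMap : ∀ σ → Holds (isoMapQF ps qs σ) ⇔ IsoMap σ
    isoMapQF⇔IsoMap σ = mk⇔ to from
      where
      to : Holds (isoMapQF ps qs σ) → IsoMap σ
      to (s₁ , s₂ , s₃) = record
        { image-≡ = λ i j → ⋀⁻ _ _ (⋀⁻ _ _ s₁ (∈-allFin i)) (∈-allFin j)
        ; image-onto = λ j → let (i , _ , h) = ⋁⁻ _ _ (⋀⁻ _ _ s₂ (∈-allFin j)) in i , h
        ; image-adj = λ i j → let (f , g) = ⋀⁻ _ _ (⋀⁻ _ _ s₃ (∈-allFin i)) (∈-allFin j) in
            T-injective (Equivalence.to (adjacentQF⇔adjInᵖ qs _ _) ∘ f ∘ Equivalence.from (adjacentQF⇔adjInᵖ ps _ _))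
                        (Equivalence.to (adjacentQF⇔adjInᵖ ps _ _) ∘ g ∘ Equivalence.from (adjacentQF⇔adjInᵖ qs _ _))
        }
      from : IsoMap σ → Holds (isoMapQF ps qs σ)
      from iσ = ⋀⁺ _ _ (λ {i} _ → ⋀⁺ _ _ (λ {j} _ → image-≡ i j))
              , ⋀⁺ _ _ (λ {j} _ → ⋁⁺ _ _ (∈-allFin _) (proj₂ (image-onto j)))
              , ⋀⁺ _ _ (λ {i} _ → ⋀⁺ _ _ (λ {j} _ →
                  (Equivalence.from (adjacentQF⇔adjInᵖ qs _ _) ∘ subst T (image-adj i j)
                     ∘ Equivalence.to (adjacentQF⇔adjInᵖ ps _ _))
                , (Equivalence.from (adjacentQF⇔adjInᵖ ps _ _) ∘ subst T (≡.sym (image-adj i j))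
                     ∘ Equivalence.to (adjacentQF⇔adjInᵖ qs _ _))))
        where open IsoMap iσ

    isoQF⇔SubgraphIso : Holds (isoQF ps qs) ⇔
      SubgraphIso (touchesᵖ (mapPairs ρ ps)) (adjInᵖ (mapPairs ρ ps)) (touchesᵖ (mapPairs ρ qs)) (adjInᵖ (mapPairs ρ qs))
    isoQF⇔SubgraphIso = mk⇔
      (λ s → let (w , _ , h) = ⋁⁻ _ _ s in IsoMap⇒SubgraphIso _ (Equivalence.to (isoMapQF⇔IsoMap _) h))
      (λ i → let (σ , iσ) = SubgraphIso⇒IsoMap i in
        ⋁⁺ _ _ (∈-allVecs (Vec.tabulate σ))
          (Equivalence.from (isoMapQF⇔IsoMap _) (IsoMap-cong (≡.sym ∘ lookup∘tabulate σ) iσ)))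

-- The sentence Φ_k

freshQF : ∀ {k} → Fin k × Fin k → List (Fin k × Fin k) → QF k
freshQF p hs = ⋀ hs (λ h → ¬′ samePairQF p h)

-- Each round binds A's edge (∀x₁ ∀x₂) and then B's answer (∃y₁ ∃y₂); in de Bruijn
-- notation the two most recently bound variables are lastPair.
lastPair : ∀ {k} → Fin (2 + k) × Fin (2 + k)
lastPair = fsuc fzero , fzero

module _ {k : ℕ} where

  redAfter blueAfter : List (Fin k × Fin k) → List (Fin (4 + k) × Fin (4 + k))
  redAfter ps = mapPairs (4 ↑ʳ_) ps ++ [ mapPair (2 ↑ʳ_) lastPair ]
  blueAfter qs = mapPairs (4 ↑ʳ_) qs ++ [ lastPair ]

module _ {k : ℕ} (ps qs : List (Fin k × Fin k)) where

  colouredForA : List (Fin (2 + k) × Fin (2 + k))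
  colouredForA = mapPairs (2 ↑ʳ_) (ps ++ qs)

  colouredForB : List (Fin (4 + k) × Fin (4 + k))
  colouredForB = mapPair (2 ↑ʳ_) lastPair ∷ mapPairs (4 ↑ʳ_) (ps ++ qs)

  challengeQF : QF (2 + k)
  challengeQF = rel′ (proj₁ lastPair) (proj₂ lastPair) ∧′ freshQF lastPair colouredForA

  answerQF : QF (4 + k)
  answerQF = rel′ (proj₁ lastPair) (proj₂ lastPair)
          ∧′ (freshQF lastPair colouredForB ∧′ isoQF (redAfter ps) (blueAfter qs))

gameFormula : (k : ℕ) → List (Fin k × Fin k) → List (Fin k × Fin k) → ℕ → Formula k
gameFormula k ps qs zero = ⊤f
gameFormula k ps qs (suc r) =
  ∀f (∀f (⌜ challengeQF ps qs ⌝ ⇒f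
    ∃f (∃f (⌜ answerQF ps qs ⌝ ∧f gameFormula (4 + k) (redAfter ps) (blueAfter qs) r))))

quantifiers-gameFormula : ∀ k ps qs r → quantifiers (gameFormula k ps qs r) ≡ 4 * r
quantifiers-gameFormula k ps qs zero = refl
quantifiers-gameFormula k ps qs (suc r) =
  trans (cong₂ (λ a b → suc (suc (a + suc (suc b)))) (quantifiers-⌜⌝ (challengeQF ps qs))
          (cong₂ _+_ (quantifiers-⌜⌝ (answerQF ps qs)) (quantifiers-gameFormula (4 + k) _ _ r)))
        (≡.sym (*-suc 4 r))

-- Satisfaction of Φ_k and the game tree

module Game (G : Graph) where

  open Edges G

  BSurvives : ℕ → List (Edge G) → List (Edge G) → Set
  BSurvives zero as bs = ⊤
  BSurvives (suc r) as bs = ∀ a → a ∉ as ++ bs → Σ (Edge G) λ b →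
    b ∉ a ∷ as ++ bs × _≅_ G (as ++ [ a ]) (bs ++ [ b ]) × BSurvives r (as ++ [ a ]) (bs ++ [ b ])

  Denotes : ∀ {k} → (Fin k → Fin (n G)) → List (Fin k × Fin k) → List (Edge G) → Set
  Denotes ρ ps es = Pointwise _≐_ (mapPairs ρ ps) (map proj₁ es)

  module _ {k : ℕ} {ρ : Fin k → Fin (n G)} where

    open Semantics G ρ

    Denotes-++ : ∀ {ps qs es fs} → Denotes ρ ps es → Denotes ρ qs fs → Denotes ρ (ps ++ qs) (es ++ fs)
    Denotes-++ {ps} {qs} {es} {fs} d d′ =
      subst₂ (Pointwise _≐_) (≡.sym (map-++ _ ps qs)) (≡.sym (map-++ proj₁ es fs)) (Pointwise.++⁺ d d′)

    Denotes-rename : ∀ {j} {ρ′ : Fin j → Fin (n G)} (f : Fin k → Fin j) → (∀ i → ρ′ (f i) ≡ ρ i) →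
      ∀ {ps es} → Denotes ρ ps es → Denotes ρ′ (mapPairs f ps) es
    Denotes-rename f ρ′f≗ρ {[]} {[]} [] = []
    Denotes-rename f ρ′f≗ρ {p ∷ ps} {_ ∷ _} (r ∷ rs) =
      subst (_≐ _) (≡.sym (cong₂ _,_ (ρ′f≗ρ (proj₁ p)) (ρ′f≗ρ (proj₂ p)))) r ∷ Denotes-rename f ρ′f≗ρ rs

    ≅⇔isoQF : ∀ {ps qs es fs} → Denotes ρ ps es → Denotes ρ qs fs → _≅_ G es fs ⇔ Holds (isoQF ps qs)
    ≅⇔isoQF {ps} {qs} {es} {fs} d d′ = mk⇔
      (Equivalence.from (IsoFormula.isoQF⇔SubgraphIso G ρ ps qs) ∘ Equivalence.to (≅⇔SubgraphIso G es fs d d′))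
      (Equivalence.from (≅⇔SubgraphIso G es fs d d′) ∘ Equivalence.to (IsoFormula.isoQF⇔SubgraphIso G ρ ps qs))

  module _ {k : ℕ} (ρ : Fin k → Fin (n G)) where

    open Semantics G ρ

    freshQF⇒∉ : ∀ p ps {hs} (e : Edge G) →
      Holds (freshQF p ps) → Denotes ρ ps hs → mapPair ρ p ≐ proj₁ e → e ∉ hs
    freshQF⇒∉ p (_ ∷ ps) {_ ∷ _} e (¬same , _) (r ∷ _) pe (here refl) = ¬same (≐-trans pe (≐-sym r))
    freshQF⇒∉ p (_ ∷ ps) {_ ∷ _} e (_ , fresh) (_ ∷ rs) pe (there e∈) = freshQF⇒∉ p ps e fresh rs pe e∈

    ∉⇒freshQF : ∀ p ps {hs} (e : Edge G) →
      e ∉ hs → Denotes ρ ps hs → mapPair ρ p ≐ proj₁ e → Holds (freshQF p ps)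
    ∉⇒freshQF p [] {[]} e e∉ [] pe = tt
    ∉⇒freshQF p (_ ∷ ps) {h ∷ _} e e∉ (r ∷ rs) pe =
      (λ same → e∉ (here (≐-edge-injective e h pe (≐-trans same r)))) , ∉⇒freshQF p ps e (e∉ ∘ there) rs pe

  gameFormula⇒BSurvives : ∀ {k} (ρ : Fin k → Fin (n G)) ps qs r {as bs} →
    Denotes ρ ps as → Denotes ρ qs bs → G ⊨ gameFormula k ps qs r ⟦ ρ ⟧ → BSurvives r as bs
  gameFormula⇒BSurvives ρ ps qs zero _ _ _ = tt
  gameFormula⇒BSurvives {k} ρ ps qs (suc r) {as} {bs} dA dB ⊨game a a∉
    with ⊨game a₁ a₂ (edge-adj a , ∉⇒freshQF ρ₂ lastPair (colouredForA ps qs) a a∉ dAB₂ (inj₁ (refl , refl)))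
    where
    a₁ a₂ : Fin (n G)
    a₁ = proj₁ (proj₁ a)
    a₂ = proj₂ (proj₁ a)
    ρ₂ : Fin (2 + k) → Fin (n G)
    ρ₂ = extend a₂ (extend a₁ ρ)
    dAB₂ : Denotes ρ₂ (mapPairs (2 ↑ʳ_) (ps ++ qs)) (as ++ bs)
    dAB₂ = Denotes-rename (2 ↑ʳ_) (λ _ → refl) (Denotes-++ dA dB)
  ... | u , v , (uv , fresh , ⊨iso) , ⊨next with adj⇒edge u v uv
  ... | b , uv≐b =
    b , b∉ , Equivalence.from (≅⇔isoQF dA′ dB′) ⊨iso , gameFormula⇒BSurvives ρ₄ _ _ r dA′ dB′ ⊨next
    where
    ρ₄ : Fin (4 + k) → Fin (n G)
    ρ₄ = extend v (extend u (extend (proj₂ (proj₁ a)) (extend (proj₁ (proj₁ a)) ρ)))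
    b∉ : b ∉ a ∷ as ++ bs
    b∉ = freshQF⇒∉ ρ₄ lastPair (colouredForB ps qs) b fresh
           (inj₁ (refl , refl) ∷ Denotes-rename (4 ↑ʳ_) (λ _ → refl) (Denotes-++ dA dB)) uv≐b
    dA′ : Denotes ρ₄ (redAfter ps) (as ∷ʳ a)
    dA′ = Denotes-++ (Denotes-rename (4 ↑ʳ_) (λ _ → refl) dA) (inj₁ (refl , refl) ∷ [])
    dB′ : Denotes ρ₄ (blueAfter qs) (bs ∷ʳ b)
    dB′ = Denotes-++ (Denotes-rename (4 ↑ʳ_) (λ _ → refl) dB) (uv≐b ∷ [])

  BSurvives⇒gameFormula : ∀ {k} (ρ : Fin k → Fin (n G)) ps qs r {as bs} →
    Denotes ρ ps as → Denotes ρ qs bs → BSurvives r as bs → G ⊨ gameFormula k ps qs r ⟦ ρ ⟧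
  BSurvives⇒gameFormula ρ ps qs zero _ _ _ = tt
  BSurvives⇒gameFormula {k} ρ ps qs (suc r) {as} {bs} dA dB survive u v (uv , fresh) with adj⇒edge u v uv
  ... | a , uv≐a with survive a (freshQF⇒∉ (extend v (extend u ρ)) lastPair (colouredForA ps qs) a fresh dAB₂ uv≐a)
    where
    dAB₂ : Denotes (extend v (extend u ρ)) (mapPairs (2 ↑ʳ_) (ps ++ qs)) (as ++ bs)
    dAB₂ = Denotes-rename (2 ↑ʳ_) (λ _ → refl) (Denotes-++ dA dB)
  ... | b , b∉ , iso , next =
    b₁ , b₂ , (edge-adj b , ∉⇒freshQF ρ₄ lastPair (colouredForB ps qs) b b∉ (uv≐a ∷ dAB₄) (inj₁ (refl , refl))
              , Equivalence.to (≅⇔isoQF dA′ dB′) iso) ,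
    BSurvives⇒gameFormula ρ₄ _ _ r dA′ dB′ next
    where
    b₁ b₂ : Fin (n G)
    b₁ = proj₁ (proj₁ b)
    b₂ = proj₂ (proj₁ b)
    ρ₄ : Fin (4 + k) → Fin (n G)
    ρ₄ = extend b₂ (extend b₁ (extend v (extend u ρ)))
    dAB₄ : Denotes ρ₄ (mapPairs (4 ↑ʳ_) (ps ++ qs)) (as ++ bs)
    dAB₄ = Denotes-rename (4 ↑ʳ_) (λ _ → refl) (Denotes-++ dA dB)
    dA′ : Denotes ρ₄ (redAfter ps) (as ∷ʳ a)
    dA′ = Denotes-++ (Denotes-rename (4 ↑ʳ_) (λ _ → refl) dA) (uv≐a ∷ [])
    dB′ : Denotes ρ₄ (blueAfter qs) (bs ∷ʳ b)
    dB′ = Denotes-++ (Denotes-rename (4 ↑ʳ_) (λ _ → refl) dB) (inj₁ (refl , refl) ∷ [])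

-- Strategies

module History (G : Graph) where

  length-histA : ∀ S₁ prev bs → length (histA G S₁ prev bs) ≡ 2 * length bs
  length-histA S₁ prev [] = refl
  length-histA S₁ prev (b ∷ bs) = trans (cong (suc ∘ suc) (length-histA S₁ (prev ∷ʳ b) bs)) (≡.sym (*-suc 2 (length bs)))

  length-histB : ∀ S₂ prev as → length (histB G S₂ prev as) ≡ 2 * length as
  length-histB S₂ prev [] = refl
  length-histB S₂ prev (a ∷ as) = trans (cong (suc ∘ suc) (length-histB S₂ (prev ∷ʳ a) as)) (≡.sym (*-suc 2 (length as)))

  histA-∷ʳ : ∀ S₁ prev bs b → histA G S₁ prev (bs ∷ʳ b) ≡ histA G S₁ prev bs ++ S₁ (prev ++ bs) ∷ b ∷ []
  histA-∷ʳ S₁ prev [] b = cong (λ p → S₁ p ∷ b ∷ []) (≡.sym (++-identityʳ prev))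
  histA-∷ʳ S₁ prev (x ∷ bs) b = cong (λ h → S₁ prev ∷ x ∷ h)
    (trans (histA-∷ʳ S₁ (prev ∷ʳ x) bs b)
           (cong (λ p → histA G S₁ (prev ∷ʳ x) bs ++ S₁ p ∷ b ∷ []) (++-assoc prev [ x ] bs)))

  histB-∷ʳ : ∀ S₂ prev as a →
    histB G S₂ prev (as ∷ʳ a) ≡ histB G S₂ prev as ++ a ∷ S₂ ((prev ++ as) ∷ʳ a) ∷ []
  histB-∷ʳ S₂ prev [] a = cong (λ p → a ∷ S₂ (p ∷ʳ a) ∷ []) (≡.sym (++-identityʳ prev))
  histB-∷ʳ S₂ prev (x ∷ as) a = cong (λ h → x ∷ S₂ (prev ∷ʳ x) ∷ h)
    (trans (histB-∷ʳ S₂ (prev ∷ʳ x) as a)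
           (cong (λ p → histB G S₂ (prev ∷ʳ x) as ++ a ∷ S₂ (p ∷ʳ a) ∷ []) (++-assoc prev [ x ] as)))

module Choice (G : Graph) (e₀ : Edge G) where

  open Edges G
  open DecMembership _≟ₑ_ using () renaming (_∈?_ to _∈ₑ?_)

  anyFresh : List (Edge G) → Edge G
  anyFresh h with length h <? edgeCount G
  ... | yes h<m = proj₁ (freshEdge h h<m)
  ... | no _ = e₀

  anyFresh-∉ : ∀ h → length h < edgeCount G → anyFresh h ∉ h
  anyFresh-∉ h h<m with length h <? edgeCount G
  ... | yes h<m′ = proj₂ (freshEdge h h<m′)
  ... | no h≮m = ⊥-elim (h≮m h<m)

  prefer : Maybe (Edge G) → List (Edge G) → Edge G
  prefer (just f) h with f ∈ₑ? h
  ... | no _ = f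
  ... | yes _ = anyFresh h
  prefer nothing h = anyFresh h

  prefer-∉ : ∀ m h → length h < edgeCount G → prefer m h ∉ h
  prefer-∉ (just f) h h<m with f ∈ₑ? h
  ... | no f∉ = f∉
  ... | yes _ = anyFresh-∉ h h<m
  prefer-∉ nothing h h<m = anyFresh-∉ h h<m

  prefer-just : ∀ {f h} → f ∉ h → prefer (just f) h ≡ f
  prefer-just {f} {h} f∉ with f ∈ₑ? h
  ... | no _ = refl
  ... | yes f∈ = ⊥-elim (f∉ f∈)

module FollowTree (G : Graph) (e₀ : Edge G) {k : ℕ} (2k≤m : 2 * k ≤ edgeCount G) where

  open Edges G
  open Game G
  open History G
  open Choice G e₀
  open DecMembership _≟ₑ_ using () renaming (_∈?_ to _∈ₑ?_)

  Position : Set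
  Position = Σ ℕ λ r → Σ (List (Edge G)) λ as → Σ (List (Edge G)) λ bs → BSurvives r as bs

  descend : ∀ {r as bs} → BSurvives (suc r) as bs → ∀ a → a ∉ as ++ bs → Edge G × Position
  descend {r} {as} {bs} w a a∉ with w a a∉
  ... | b , _ , _ , w′ = b , r , as ∷ʳ a , bs ∷ʳ b , w′

  advance : Position → Edge G → Maybe (Edge G × Position)
  advance (zero , _) a = nothing
  advance (suc r , as , bs , w) a with a ∈ₑ? as ++ bs
  ... | yes _ = nothing
  ... | no a∉ = just (descend w a a∉)

  advance-fresh : ∀ r as bs (w : BSurvives (suc r) as bs) a → a ∉ as ++ bs →
    Σ (a ∉ as ++ bs) λ a∉ → advance (suc r , as , bs , w) a ≡ just (descend w a a∉)
  advance-fresh r as bs w a a∉ with a ∈ₑ? as ++ bs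
  ... | yes a∈ = ⊥-elim (a∉ a∈)
  ... | no a∉′ = a∉′ , refl

  -- B's answers depend on its own earlier answers; rather than defining the strategy as a
  -- fixpoint, it carries them, with its position in the tree, in a memory folded over A's moves.
  record Memory : Set where
    constructor memo
    field
      history : List (Edge G)
      position : Maybe Position
      lastAnswer : Edge G
  open Memory

  answer : Memory → Edge G → Edge G
  answer m a = prefer (position m >>= λ p → Maybe.map proj₁ (advance p a)) (history m ∷ʳ a)

  remember : Memory → Edge G → Memory
  remember m a = memo (history m ++ a ∷ answer m a ∷ []) (position m >>= λ p → Maybe.map proj₂ (advance p a)) (answer m a)

  module _ (w₀ : BSurvives k [] []) where

    memory : List (Edge G) → Memory
    memory = foldl remember (memo [] (just (k , [] , [] , w₀)) e₀)

    S₂ : StrategyB G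
    S₂ as = lastAnswer (memory as)

    memory-∷ʳ : ∀ as a → memory (as ∷ʳ a) ≡ remember (memory as) a
    memory-∷ʳ as a = foldl-∷ʳ remember _ a as

    history-∷ʳ : ∀ as a → history (memory (as ∷ʳ a)) ≡ history (memory as) ++ a ∷ S₂ (as ∷ʳ a) ∷ []
    history-∷ʳ as a rewrite memory-∷ʳ as a = refl

    history-memory : ∀ prev as → history (memory (prev ++ as)) ≡ history (memory prev) ++ histB G S₂ prev as
    history-memory prev [] = trans (cong (history ∘ memory) (++-identityʳ prev)) (≡.sym (++-identityʳ _))
    history-memory prev (a ∷ as) =
      trans (cong (history ∘ memory) (≡.sym (++-assoc prev [ a ] as)))
        (trans (history-memory (prev ∷ʳ a) as)
          (trans (cong (_++ histB G S₂ (prev ∷ʳ a) as) (history-∷ʳ prev a))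
            (++-assoc (history (memory prev)) _ _)))

    legal₂ : LegalB G S₂
    legal₂ as a bound _ = subst₂ _∉_ (cong lastAnswer (≡.sym (memory-∷ʳ as a))) (cong (_∷ʳ a) (history-memory [] as))
      (prefer-∉ (position (memory as) >>= λ p → Maybe.map proj₁ (advance p a)) (history (memory as) ∷ʳ a)
                (subst (_< edgeCount G) (≡.sym length≡) bound))
      where
      length≡ : length (history (memory as) ∷ʳ a) ≡ suc (2 * length as)
      length≡ = trans (length-∷ʳ (history (memory as)) a)
                      (cong suc (trans (cong length (history-memory [] as)) (length-histB S₂ [] as)))

    answer-follows-tree : ∀ {r as bs} (w : BSurvives (suc r) as bs) {a} → a ∉ as ++ bs →
      position (memory as) ≡ just (suc r , as , bs , w) → histB G S₂ [] as ↭ as ++ bs →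
      Σ (a ∉ as ++ bs) λ a∉ →
        S₂ (as ∷ʳ a) ≡ proj₁ (descend w a a∉) × position (memory (as ∷ʳ a)) ≡ just (proj₂ (descend w a a∉))
    answer-follows-tree {r} {as} {bs} w {a} a∉ at h↭ with advance-fresh r as bs w a a∉
    ... | a∉′ , adv = a∉′ , S₂≡b , position≡
      where
      h : List (Edge G)
      h = histB G S₂ [] as
      b : Edge G
      b = proj₁ (w a a∉′)
      S₂≡b : S₂ (as ∷ʳ a) ≡ b
      S₂≡b = begin
        S₂ (as ∷ʳ a)
          ≡⟨ cong lastAnswer (memory-∷ʳ as a) ⟩
        answer (memory as) a
          ≡⟨ cong₂ (λ mp hist → prefer (mp >>= λ p → Maybe.map proj₁ (advance p a)) (hist ∷ʳ a))
                   at (history-memory [] as) ⟩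
        prefer (Maybe.map proj₁ (advance (suc r , as , bs , w) a)) (h ∷ʳ a)
          ≡⟨ cong (λ m → prefer (Maybe.map proj₁ m) (h ∷ʳ a)) adv ⟩
        prefer (just b) (h ∷ʳ a)
          ≡⟨ prefer-just (∉∷⇒∉∷ʳ h↭ (proj₁ (proj₂ (w a a∉′)))) ⟩
        b ∎
        where open ≡.≡-Reasoning
      position≡ : position (memory (as ∷ʳ a)) ≡ just (proj₂ (descend w a a∉′))
      position≡ = trans (cong position (memory-∷ʳ as a))
                    (trans (cong (_>>= λ p → Maybe.map proj₂ (advance p a)) at) (cong (Maybe.map proj₂) adv))

    module _ (S₁ : StrategyA G) (legal₁ : LegalA G S₁) where

      record Tracks (i : ℕ) (as bs : List (Edge G)) : Set where
        field
          left : ℕ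
          tree : BSurvives left as bs
          left+i≡k : left + i ≡ k
          at-tree : position (memory as) ≡ just (left , as , bs , tree)
          same-history : histA G S₁ [] bs ≡ histB G S₂ [] as
          history↭ : histB G S₂ [] as ↭ as ++ bs
          history-unique : Unique (histB G S₂ [] as)
          isomorphic : _≅_ G as bs

      length-play : ∀ i → length (proj₂ (play G S₁ S₂ i)) ≡ i
      length-play zero = refl
      length-play (suc i) = trans (length-∷ʳ (proj₂ (play G S₁ S₂ i)) _) (cong suc (length-play i))

      round : ∀ {i as bs} → length bs ≡ i → suc i ≤ k → Tracks i as bs →
        Tracks (suc i) (as ∷ʳ S₁ bs) (bs ∷ʳ S₂ (as ∷ʳ S₁ bs))
      round {i} _ i<k record { left = zero ; left+i≡k = i≡k } = ⊥-elim (1+n≰n (subst (suc i ≤_) (≡.sym i≡k) i<k))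
      round {i} {as} {bs} len i<k record { left = suc r ; tree = w ; left+i≡k = r+i≡k ; at-tree = at
                                        ; same-history = same ; history↭ = h↭ ; history-unique = u } =
        subst (λ b → Tracks (suc i) (as ∷ʳ a) (bs ∷ʳ b)) (≡.sym S₂≡b) (record
          { left = r
          ; tree = proj₂ (proj₂ (proj₂ (w a a∉′)))
          ; left+i≡k = trans (+-suc r i) r+i≡k
          ; at-tree = proj₂ (proj₂ followed)
          ; same-history = trans (histA-∷ʳ S₁ [] bs b) (trans (cong (_++ a ∷ b ∷ []) same) (≡.sym history′))
          ; history↭ = subst (_↭ (as ∷ʳ a) ++ (bs ∷ʳ b)) (≡.sym history′) (↭-round as bs h↭)
          ; history-unique = subst Unique (≡.sym history′) (Unique-round u a∉h b∉h)
          ; isomorphic = proj₁ (proj₂ (proj₂ (w a a∉′)))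
          })
        where
        a : Edge G
        a = S₁ bs
        h : List (Edge G)
        h = histB G S₂ [] as
        a∉h : a ∉ h
        a∉h = subst (a ∉_) same (legal₁ bs (subst (λ j → 2 * j < edgeCount G) (≡.sym len)
                                                  (≤-trans (n≤1+n _) (2+2*i≤m i<k 2k≤m)))
                                            (subst Unique (≡.sym same) u))
        followed : Σ (a ∉ as ++ bs) λ a∉ →
          S₂ (as ∷ʳ a) ≡ proj₁ (descend w a a∉) × position (memory (as ∷ʳ a)) ≡ just (proj₂ (descend w a a∉))
        followed = answer-follows-tree w (a∉h ∘ ∈-resp-↭ (↭-sym h↭)) at h↭
        a∉′ : a ∉ as ++ bs
        a∉′ = proj₁ followed
        b : Edge G
        b = proj₁ (w a a∉′)
        S₂≡b : S₂ (as ∷ʳ a) ≡ b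
        S₂≡b = proj₁ (proj₂ followed)
        b∉h : b ∉ h ∷ʳ a
        b∉h = ∉∷⇒∉∷ʳ h↭ (proj₁ (proj₂ (w a a∉′)))
        history′ : histB G S₂ [] (as ∷ʳ a) ≡ h ++ a ∷ b ∷ []
        history′ = trans (histB-∷ʳ S₂ [] as a) (cong (λ b′ → h ++ a ∷ b′ ∷ []) S₂≡b)

      tracks : ∀ i → i ≤ k → Tracks i (proj₁ (play G S₁ S₂ i)) (proj₂ (play G S₁ S₂ i))
      tracks zero _ = record
        { left = k ; tree = w₀ ; left+i≡k = +-identityʳ k ; at-tree = refl ; same-history = refl
        ; history↭ = ↭-refl ; history-unique = [] ; isomorphic = ↔-refl , λ _ _ → refl }
      tracks (suc i) i<k = round (length-play i) i<k (tracks i (≤-trans (n≤1+n i) i<k))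

    BSurvives⇒LAtLeast : LAtLeast G k
    BSurvives⇒LAtLeast = S₂ , legal₂ , λ S₁ legal₁ →
      2*k≤m⇒k≤m/2 2k≤m , λ i i≤k → Tracks.isomorphic (tracks S₁ legal₁ i i≤k)

module FollowTarget (G : Graph) (e₀ : Edge G) {k : ℕ} (2k≤m : 2 * k ≤ edgeCount G)
  (S₂ : StrategyB G) (legal₂ : LegalB G S₂) (wins : ∀ S₁ → LegalA G S₁ → lAtLeast G S₁ S₂ k) where

  open Game G
  open History G
  open Choice G e₀

  responses : List (Edge G) → List (Edge G) → List (Edge G)
  responses prev [] = []
  responses prev (a ∷ as) = S₂ (prev ∷ʳ a) ∷ responses (prev ∷ʳ a) as

  responses-∷ʳ : ∀ prev as a → responses prev (as ∷ʳ a) ≡ responses prev as ∷ʳ S₂ ((prev ++ as) ∷ʳ a)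
  responses-∷ʳ prev [] a = cong (λ p → S₂ (p ∷ʳ a) ∷ []) (≡.sym (++-identityʳ prev))
  responses-∷ʳ prev (x ∷ as) a = cong (S₂ (prev ∷ʳ x) ∷_)
    (trans (responses-∷ʳ (prev ∷ʳ x) as a)
           (cong (λ p → responses (prev ∷ʳ x) as ∷ʳ S₂ (p ∷ʳ a)) (++-assoc prev [ x ] as)))

  histB↭ : ∀ prev as → histB G S₂ prev as ↭ as ++ responses prev as
  histB↭ prev [] = ↭-refl
  histB↭ prev (a ∷ as) = ↭-prep a (↭-trans (↭-prep _ (histB↭ (prev ∷ʳ a) as)) (↭-sym (shift _ as _)))

  module Target (T : List (Edge G)) where

    Memory : Set
    Memory = List (Edge G) × List (Edge G)

    move : Memory → Edge G
    move (h , rest) = prefer (head rest) h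

    remember : Memory → Edge G → Memory
    remember m b = proj₁ m ++ move m ∷ b ∷ [] , drop 1 (proj₂ m)

    memory : List (Edge G) → Memory
    memory = foldl remember ([] , T)

    S₁ : StrategyA G
    S₁ bs = move (memory bs)

    memory-∷ʳ : ∀ bs b → memory (bs ∷ʳ b) ≡ remember (memory bs) b
    memory-∷ʳ bs b = foldl-∷ʳ remember _ b bs

    history-memory : ∀ prev bs → proj₁ (memory (prev ++ bs)) ≡ proj₁ (memory prev) ++ histA G S₁ prev bs
    history-memory prev [] = trans (cong (proj₁ ∘ memory) (++-identityʳ prev)) (≡.sym (++-identityʳ _))
    history-memory prev (b ∷ bs) =
      trans (cong (proj₁ ∘ memory) (≡.sym (++-assoc prev [ b ] bs)))
        (trans (history-memory (prev ∷ʳ b) bs)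
          (trans (cong (λ m → proj₁ m ++ histA G S₁ (prev ∷ʳ b) bs) (memory-∷ʳ prev b))
            (++-assoc (proj₁ (memory prev)) _ _)))

    legal₁ : LegalA G S₁
    legal₁ bs bound _ = subst (S₁ bs ∉_) (history-memory [] bs)
      (prefer-∉ (head (proj₂ (memory bs))) (proj₁ (memory bs)) (subst (_< edgeCount G) (≡.sym length≡) bound))
      where
      length≡ : length (proj₁ (memory bs)) ≡ 2 * length bs
      length≡ = trans (cong length (history-memory [] bs)) (length-histA S₁ [] bs)

    follows : ∀ {α} → Reverse α → ∀ rest → α ++ rest ≡ T → Unique (histB G S₂ [] α) →
      play G S₁ S₂ (length α) ≡ (α , responses [] α) × memory (responses [] α) ≡ (histB G S₂ [] α , rest)
    follows [] rest refl _ = refl , refl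
    follows (α ∶ rα ∶ʳ x) rest α∷ʳx++rest≡T u = played , remembered
      where
      h : List (Edge G)
      h = histB G S₂ [] α
      f : Edge G
      f = S₂ (α ∷ʳ x)
      h′ : histB G S₂ [] (α ∷ʳ x) ≡ h ++ x ∷ f ∷ []
      h′ = histB-∷ʳ S₂ [] α x
      u′ : Unique (h ++ x ∷ f ∷ [])
      u′ = subst Unique h′ u
      ih : play G S₁ S₂ (length α) ≡ (α , responses [] α) × memory (responses [] α) ≡ (h , x ∷ rest)
      ih = follows rα (x ∷ rest) (trans (≡.sym (++-assoc α [ x ] rest)) α∷ʳx++rest≡T) (Unique-++⁻ˡ h u′)
      S₁≡x : S₁ (responses [] α) ≡ x
      S₁≡x = trans (cong move (proj₂ ih)) (prefer-just (Unique-++-∷⇒∉ h u′))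
      nextRound : List (Edge G) × List (Edge G) → List (Edge G) × List (Edge G)
      nextRound (as , bs) = as ∷ʳ S₁ bs , bs ∷ʳ S₂ (as ∷ʳ S₁ bs)
      played : play G S₁ S₂ (length (α ∷ʳ x)) ≡ (α ∷ʳ x , responses [] (α ∷ʳ x))
      played = begin
        play G S₁ S₂ (length (α ∷ʳ x))
          ≡⟨ cong (play G S₁ S₂) (length-∷ʳ α x) ⟩
        nextRound (play G S₁ S₂ (length α))
          ≡⟨ cong nextRound (proj₁ ih) ⟩
        α ∷ʳ S₁ (responses [] α) , responses [] α ∷ʳ S₂ (α ∷ʳ S₁ (responses [] α))
          ≡⟨ cong (λ y → α ∷ʳ y , responses [] α ∷ʳ S₂ (α ∷ʳ y)) S₁≡x ⟩
        α ∷ʳ x , responses [] α ∷ʳ f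
          ≡⟨ cong (α ∷ʳ x ,_) (≡.sym (responses-∷ʳ [] α x)) ⟩
        α ∷ʳ x , responses [] (α ∷ʳ x) ∎
        where open ≡.≡-Reasoning
      remembered : memory (responses [] (α ∷ʳ x)) ≡ (histB G S₂ [] (α ∷ʳ x) , rest)
      remembered = begin
        memory (responses [] (α ∷ʳ x))
          ≡⟨ cong memory (responses-∷ʳ [] α x) ⟩
        memory (responses [] α ∷ʳ f)
          ≡⟨ memory-∷ʳ (responses [] α) f ⟩
        remember (memory (responses [] α)) f
          ≡⟨ cong (λ m → remember m f) (proj₂ ih) ⟩
        h ++ prefer (just x) h ∷ f ∷ [] , rest
          ≡⟨ cong (λ y → h ++ y ∷ f ∷ [] , rest) (prefer-just (Unique-++-∷⇒∉ h u′)) ⟩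
        h ++ x ∷ f ∷ [] , rest
          ≡⟨ cong (_, rest) (≡.sym h′) ⟩
        histB G S₂ [] (α ∷ʳ x) , rest ∎
        where open ≡.≡-Reasoning

  survives : ∀ r α → length α + r ≡ k → Unique (histB G S₂ [] α) → BSurvives r α (responses [] α)
  survives zero _ _ _ = tt
  survives (suc r) α len u a a∉ =
    b , b∉ , iso , subst (BSurvives r (α ∷ʳ a)) (responses-∷ʳ [] α a) (survives r (α ∷ʳ a) len′ u′)
    where
    h : List (Edge G)
    h = histB G S₂ [] α
    a∉h : a ∉ h
    a∉h = a∉ ∘ ∈-resp-↭ (histB↭ [] α)
    sα≤k : suc (length α) ≤ k
    sα≤k = subst (suc (length α) ≤_) (trans (≡.sym (+-suc (length α) r)) len) (s≤s (m≤m+n (length α) r))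
    b : Edge G
    b = S₂ (α ∷ʳ a)
    b∉h : b ∉ h ∷ʳ a
    b∉h = legal₂ α a (2+2*i≤m sα≤k 2k≤m) (Unique-∷ʳ u a∉h)
    b∉ : b ∉ a ∷ α ++ responses [] α
    b∉ = ∉∷ʳ⇒∉∷ (histB↭ [] α) b∉h
    u′ : Unique (histB G S₂ [] (α ∷ʳ a))
    u′ = subst Unique (≡.sym (histB-∷ʳ S₂ [] α a)) (Unique-round u a∉h b∉h)
    len′ : length (α ∷ʳ a) + r ≡ k
    len′ = trans (cong (_+ r) (length-∷ʳ α a)) (trans (≡.sym (+-suc (length α) r)) len)
    open Target (α ∷ʳ a)
    iso : _≅_ G (α ∷ʳ a) (responses [] α ∷ʳ b)
    iso = subst (λ p → _≅_ G (proj₁ p) (proj₂ p))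
            (trans (proj₁ (follows (reverseView (α ∷ʳ a)) [] (++-identityʳ _) u′))
                   (cong (α ∷ʳ a ,_) (responses-∷ʳ [] α a)))
            (proj₂ (wins S₁ legal₁) (length (α ∷ʳ a)) (subst (_≤ k) (≡.sym (length-∷ʳ α a)) sα≤k))

  LAtLeast⇒BSurvives : BSurvives k [] []
  LAtLeast⇒BSurvives = survives k [] refl []

lemma3p3 : (k : ℕ) → 1 ≤ k →
    Σ Sentence (λ Φ → (quantifiers Φ ≡ 4 * k) ×
      ((G : Graph) → 2 * k ≤ edgeCount G → ((G ⊨ Φ) ⇔ LAtLeast G k)))
lemma3p3 k 1≤k = gameFormula 0 [] [] k , quantifiers-gameFormula 0 [] [] k , λ G 2k≤m →
  let open Game G
      e₀ : Edge G
      e₀ = proj₁ (Edges.freshEdge G [] (≤-trans 1≤k (≤-trans (m≤m+n k (1 * k)) 2k≤m)))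
  in mk⇔
    (λ ⊨Φ → FollowTree.BSurvives⇒LAtLeast G e₀ 2k≤m (gameFormula⇒BSurvives _ [] [] k [] [] ⊨Φ))
    (λ (S₂ , legal₂ , wins) →
      BSurvives⇒gameFormula _ [] [] k [] [] (FollowTarget.LAtLeast⇒BSurvives G e₀ 2k≤m S₂ legal₂ wins))
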